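{- Let $s=(s(1),s(2),\ldots,s(n))$ be a sequence of positive integers. Then the $s$-permutahedron has a Hamilton path. That is, the undirected graph whose vertices are the $s$-decreasing trees and whose edges join two trees $T,T'$ whenever one covers the other in the $s$-weak order contains a path that visits every $s$-decreasing tree exactly once.
   Context: An $s$-decreasing tree is a planar (ordered) rooted tree with $n$ internal nodes labeled $1,2,\ldots,n$. Internal node $i$ has exactly $s(i)+1$ ordered children, each of which is either an internal node or a leaf. The labels of all descendants of $i$ are smaller than $i$. For an internal node $c$, number its subtrees $T_0,T_1,\ldots,T_{s(c)}$ from left to right. For labels $a<c$, the tree-inversion number $\mathrm{card}_T(c,a)$ is defined as follows: - It is $i$ if $a$ lies in the subtree $T_i$ of $c$. - It is $0$ if $a$ is not a descendant of $c$ and lies to the left of $c$. Here left and right are determined by the order of the children of the lowest common ancestor of $a$ and $c$. - It is $s(c)$ if $a$ is not a descendant of $c$ and lies to the right of $c$. The $s$-weak order on $s$-decreasing trees is the partial order given by $T\le T'$ if and only if $\mathrm{card}_T(c,a)\le \mathrm{card}_{T'}(c,a)$ for all $1\le a<c\le n$. The $s$-permutahedron (in the sense of Ceballos and Pons) is this poset, and its graph is the cover graph (undirected Hasse diagram) of the $s$-weak order. -}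

module Defs where

open import Data.Nat using (ℕ; zero; suc; _≤_; _<_; _≟_; _<ᵇ_)
open import Data.Bool using (if_then_else_)
open import Data.List using (List; []; _∷_; _++_; map; upTo; concatMap; length)
open import Data.List.Relation.Unary.All using (All)
open import Data.List.Relation.Unary.Unique.Propositional using (Unique)
open import Data.List.Relation.Unary.Linked using (Linked)
open import Data.List.Membership.Propositional using (_∈_)
open import Data.List.Relation.Binary.Permutation.Propositional using (_↭_)
open import Data.Maybe using (Maybe; just; nothing; _<∣>_)
import Data.Maybe as Maybe
open import Data.Product using (_×_; ∃)
open import Data.Sum using (_⊎_)
open import Relation.Nullary using (¬_; yes; no)
open import Relation.Binary.PropositionalEquality using (_≡_; _≢_)

data Tree : Set where
  leaf : Tree
  node : ℕ → List Tree → Tree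

mutual
  labels : Tree → List ℕ
  labels leaf = []
  labels (node i cs) = i ∷ labelsList cs

  labelsList : List Tree → List ℕ
  labelsList [] = []
  labelsList (t ∷ ts) = labels t ++ labelsList ts

mutual
  data WF (s : ℕ → ℕ) : Tree → Set where
    wf-leaf : WF s leaf
    wf-node : ∀ {i cs} → length cs ≡ suc (s i)
            → All (λ c → All (_< i) (labels c)) cs
            → WFList s cs
            → WF s (node i cs)

  data WFList (s : ℕ → ℕ) : List Tree → Set where
    wf-[] : WFList s []
    wf-∷  : ∀ {t ts} → WF s t → WFList s ts → WFList s (t ∷ ts)

oneTo : ℕ → List ℕ
oneTo n = map suc (upTo n)

SDec : (s : ℕ → ℕ) → ℕ → Tree → Set
SDec s n T = WF s T × (labels T ↭ oneTo n)

-- Path (list of child indices, 0-based, from the root) to the internal node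
-- labelled x, if any.
mutual
  pathTo : ℕ → Tree → Maybe (List ℕ)
  pathTo x leaf = nothing
  pathTo x (node i cs) with x ≟ i
  ... | yes _ = just []
  ... | no _  = pathList x 0 cs

  pathList : ℕ → ℕ → List Tree → Maybe (List ℕ)
  pathList x k [] = nothing
  pathList x k (t ∷ ts) = Maybe.map (k ∷_) (pathTo x t) <∣> pathList x (suc k) ts

cmpPath : (s : ℕ → ℕ) → ℕ → List ℕ → List ℕ → ℕ
cmpPath s c [] [] = 0              -- a = c (does not occur)
cmpPath s c [] (i ∷ _) = i         -- a lies in subtree T_i of c
cmpPath s c (_ ∷ _) [] = s c       -- a is an ancestor of c (does not occur for a < c)
cmpPath s c (j ∷ pc) (i ∷ pa) with i ≟ j
... | yes _ = cmpPath s c pc pa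
... | no _  = if i <ᵇ j then 0 else s c   -- a left of c: 0, right of c: s(c)

card : (s : ℕ → ℕ) → Tree → ℕ → ℕ → ℕ
card s T c a with pathTo c T | pathTo a T
... | just pc | just pa = cmpPath s c pc pa
... | _       | _       = 0

_≤[_,_]_ : Tree → (ℕ → ℕ) → ℕ → Tree → Set
T ≤[ s , n ] T' = ∀ a c → 1 ≤ a → a < c → c ≤ n → card s T c a ≤ card s T' c a

_<[_,_]_ : Tree → (ℕ → ℕ) → ℕ → Tree → Set
T <[ s , n ] T' = T ≤[ s , n ] T' × T ≢ T'

Covers : (ℕ → ℕ) → ℕ → Tree → Tree → Set
Covers s n T T' = SDec s n T × SDec s n T' × T <[ s , n ] T'
  × (∀ U → SDec s n U → T <[ s , n ] U → ¬ (U <[ s , n ] T'))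

Adjacent : (ℕ → ℕ) → ℕ → Tree → Tree → Set
Adjacent s n T T' = Covers s n T T' ⊎ Covers s n T' T

HamiltonPath : (ℕ → ℕ) → ℕ → List Tree → Set
HamiltonPath s n p = All (SDec s n) p × Unique p
  × (∀ T → SDec s n T → T ∈ p) × Linked (Adjacent s n) p

module Submission where

open import Defs
open import Data.Nat using (ℕ; zero; suc; _+_; _≤_; _<_; _≟_; _<ᵇ_; z≤n; s≤s)
open import Data.Nat.Properties
open import Data.Bool using (Bool; true; false; not)
open import Data.List using (List; []; _∷_; _++_; map; length; replicate; head; last; reverse)
open import Data.List.Properties
  using (++-assoc; ++-identityʳ; ∷-injectiveʳ; length-replicate; head-map; last-map; unfold-reverse; reverse-involutive)
open import Data.List.Membership.Propositional using (_∈_; _∉_)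
open import Data.List.Membership.Propositional.Properties using (∈-++⁺ˡ; ∈-++⁺ʳ; ∈-++⁻; ∈-map⁺; ∈-map⁻)
open import Data.List.Relation.Unary.Any using (here; there)
open import Data.List.Relation.Unary.All using (All; []; _∷_)
import Data.List.Relation.Unary.All as All
import Data.List.Relation.Unary.All.Properties as All
open import Data.List.Relation.Unary.AllPairs using (AllPairs; []; _∷_)
import Data.List.Relation.Unary.AllPairs as AllPairs
import Data.List.Relation.Unary.AllPairs.Properties as AllPairs
open import Data.List.Relation.Unary.Linked using (Linked; []; [-]; _∷_)
import Data.List.Relation.Unary.Linked as Linked
import Data.List.Relation.Unary.Linked.Properties as Linked
open import Data.List.Relation.Unary.Unique.Propositional using (Unique)
import Data.List.Relation.Unary.Unique.Propositional.Properties as Unique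
open import Data.List.Relation.Binary.Disjoint.Propositional using (Disjoint)
open import Data.List.Relation.Binary.Permutation.Propositional
  using (_↭_; ↭-refl; ↭-sym; ↭-trans; ↭-reflexive; prep; ↭⇒↭ₛ)
open import Data.List.Relation.Binary.Permutation.Propositional.Properties
  using (++⁺ˡ; ++⁺ʳ; shift; shifts; All-resp-↭; ∈-resp-↭; ↭-reverse; drop-∷; ¬x∷xs↭[])
import Data.List.Relation.Binary.Permutation.Setoid.Properties as Permutation
open import Data.Maybe using (Maybe; just; nothing)
import Data.Maybe as Maybe
open import Data.Maybe.Properties using (just-injective)
open import Data.Maybe.Relation.Binary.Connected using (Connected; just; just-nothing)
open import Data.Product using (_×_; _,_; ∃; ∃₂; proj₁; proj₂)
open import Data.Sum using (_⊎_; inj₁; inj₂)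
open import Function using (id; flip; _∘_)
open import Relation.Binary.Definitions using (Reflexive)
open import Relation.Binary.PropositionalEquality
open import Relation.Nullary using (¬_; yes; no; contradiction; ofʸ; ofⁿ)

-- In an s-decreasing tree the node with the smallest label m has only leaves as
-- children, so pruning it leaves a tree R on the other labels, and the tree is recovered
-- by grafting the corolla of m back at that leaf of R.  Grafting at a leaf keeps all
-- inversions of R and adds the values card(c, m), which depend only on the leaf.  Going
-- through the leaves of R from left to right, these values increase one at a time, so
-- the graftings at consecutive leaves are covers.  At the first leaf all of them are 0
-- and at the last leaf all are s(c), so a cover R ⋖ R′ lifts to a cover between the
-- graftings at the first (or at the last) leaves.  Hence, as in the Steinhaus–Johnson–
-- Trotter order, a Hamilton path R₁, R₂, … on the labels above m gives one on all
-- labels: graft m at the leaves of R₁ from left to right, then at those of R₂ from right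
-- to left, and so on.

just≢nothing : ∀ {A : Set} {a : A} → just a ≢ nothing
just≢nothing ()

head-++ : ∀ {A : Set} {x : A} xs {ys} → head xs ≡ just x → head (xs ++ ys) ≡ just x
head-++ (_ ∷ _) e = e

last-++ : ∀ {A : Set} {y : A} xs {ys} → last ys ≡ just y → last (xs ++ ys) ≡ just y
last-++ []           e = e
last-++ (_ ∷ [])     {ys = _ ∷ _} e = e
last-++ (_ ∷ x ∷ xs) e = last-++ (x ∷ xs) e

head⇒∈ : ∀ {A : Set} {x : A} xs → head xs ≡ just x → x ∈ xs
head⇒∈ (_ ∷ _) refl = here refl

last⇒∈ : ∀ {A : Set} {x : A} xs → last xs ≡ just x → x ∈ xs
last⇒∈ (_ ∷ [])     refl = here refl
last⇒∈ (_ ∷ y ∷ ys) e    = there (last⇒∈ (y ∷ ys) e)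

last-reverse : ∀ {A : Set} (xs : List A) → last (reverse xs) ≡ head xs
last-reverse []       = refl
last-reverse (x ∷ xs) = trans (cong last (unfold-reverse x xs)) (last-++ (reverse xs) refl)

head-reverse : ∀ {A : Set} (xs : List A) → head (reverse xs) ≡ last xs
head-reverse xs = trans (sym (last-reverse (reverse xs))) (cong last (reverse-involutive xs))

Unique-++⁻ : ∀ {A : Set} xs {ys : List A} → Unique (xs ++ ys) → Unique xs × Unique ys × Disjoint xs ys
Unique-++⁻ []       u         = [] , u , λ ()
Unique-++⁻ (x ∷ xs) (x∉ ∷ u) with Unique-++⁻ xs u
... | uxs , uys , xs#ys = All.++⁻ˡ xs x∉ ∷ uxs , uys , disjoint
  where
  disjoint : Disjoint (x ∷ xs) _
  disjoint (here refl , v∈ys) = All.lookup (All.++⁻ʳ xs x∉) v∈ys refl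
  disjoint (there v∈xs , v∈ys) = xs#ys (v∈xs , v∈ys)

Unique-map⁺-∈ : ∀ {A B : Set} {f : A → B} {xs} → (∀ {a b} → a ∈ xs → b ∈ xs → f a ≡ f b → a ≡ b)
              → Unique xs → Unique (map f xs)
Unique-map⁺-∈ inj [] = []
Unique-map⁺-∈ inj (x∉ ∷ u) =
  All.map⁺ (All.tabulate λ y∈ fx≡fy → All.lookup x∉ y∈ (inj (here refl) (there y∈) fx≡fy))
    ∷ Unique-map⁺-∈ (λ a∈ b∈ → inj (there a∈) (there b∈)) u

Linked-mapWith∈ : ∀ {A : Set} {R S : A → A → Set} {xs} → (∀ {a b} → a ∈ xs → b ∈ xs → R a b → S a b)
                → Linked R xs → Linked S xs
Linked-mapWith∈ f []      = []
Linked-mapWith∈ f [-]     = [-]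
Linked-mapWith∈ f (r ∷ l) =
  f (here refl) (there (here refl)) r ∷ Linked-mapWith∈ (λ a∈ b∈ → f (there a∈) (there b∈)) l

Connected-last-head : ∀ {A : Set} {R : A → A → Set} {a} xs ys → last xs ≡ just a
                    → (∀ {b} → head ys ≡ just b → R a b) → Connected R (last xs) (head ys)
Connected-last-head xs []      e _ rewrite e = just-nothing
Connected-last-head xs (b ∷ _) e r rewrite e = just (r refl)

Linked-reverse : ∀ {A : Set} {R : A → A → Set} {xs} → Linked R xs → Linked (flip R) (reverse xs)
Linked-reverse []                             = []
Linked-reverse [-]                            = [-]
Linked-reverse {R = R} {x ∷ y ∷ xs} (r ∷ l) =
  subst (Linked (flip R)) (sym (unfold-reverse x (y ∷ xs)))
    (Linked.++⁺ (Linked-reverse l)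
      (Connected-last-head (reverse (y ∷ xs)) (x ∷ []) (last-reverse (y ∷ xs)) λ { refl → r }) [-])

record UnitStep {A : Set} (F : ℕ → A → ℕ) (p q : A) : Set where
  constructor unitStep
  field
    coord : ℕ
    up    : F coord q ≡ suc (F coord p)
    fixed : ∀ c → c ≢ coord → F c q ≡ F c p

Track : ∀ {A B : Set} → (ℕ → A → ℕ) → A → A → (ℕ → B → ℕ) → B → B → ℕ → Set
Track G p′ q′ F p q c = (G c p′ ≡ F c p × G c q′ ≡ F c q) ⊎ (G c p′ ≡ G c q′ × F c p ≡ F c q)

record Tracks {A B : Set} (G : ℕ → A → ℕ) (p′ q′ : A) (F : ℕ → B → ℕ) (p q : B) : Set where
  constructor tracks
  field
    track : ∀ c → Track G p′ q′ F p q c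

UnitStep-transfer : ∀ {A B : Set} {G : ℕ → A → ℕ} {F : ℕ → B → ℕ} {p′ q′ p q}
                  → Tracks G p′ q′ F p q → UnitStep F p q → UnitStep G p′ q′
UnitStep-transfer {G = G} {F} {p′} {q′} {p} {q} (tracks tr) (unitStep c₀ up fixed) = unitStep c₀ (up′ (tr c₀)) fixed′
  where
  up′ : Track G p′ q′ F p q c₀ → G c₀ q′ ≡ suc (G c₀ p′)
  up′ (inj₁ (ep , eq)) = trans eq (trans up (cong suc (sym ep)))
  up′ (inj₂ (_ , e))   = contradiction (sym (trans e up)) 1+n≢n
  fixed′ : ∀ c → c ≢ c₀ → G c q′ ≡ G c p′
  fixed′ c c≢c₀ with tr c
  ... | inj₁ (ep , eq) = trans eq (trans (fixed c c≢c₀) (sym ep))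
  ... | inj₂ (e , _)   = sym e

agree-transfer : ∀ {A B : Set} {G : ℕ → A → ℕ} {F : ℕ → B → ℕ} {p′ q′ p q}
               → Tracks G p′ q′ F p q → (∀ c → G c p′ ≡ G c q′) → ∀ c → F c p ≡ F c q
agree-transfer (tracks tr) agree c with tr c
... | inj₁ (ep , eq) = trans (sym ep) (trans (agree c) eq)
... | inj₂ (_ , e)   = e

UnitStep-between : ∀ {A : Set} {F : ℕ → A → ℕ} {p q r} → UnitStep F p q
                 → (∀ c → F c p ≤ F c r) → (∀ c → F c r ≤ F c q)
                 → (∀ c → F c r ≡ F c p) ⊎ (∀ c → F c r ≡ F c q)
UnitStep-between {F = F} {p} {q} {r} (unitStep c₀ up fixed) p≤r r≤q with F c₀ r ≟ F c₀ p
... | yes eq = inj₁ atP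
  where
  atP : ∀ c → F c r ≡ F c p
  atP c with c ≟ c₀
  ... | yes refl = eq
  ... | no c≢c₀  = ≤-antisym (subst (F c r ≤_) (fixed c c≢c₀) (r≤q c)) (p≤r c)
... | no neq = inj₂ atQ
  where
  atQ : ∀ c → F c r ≡ F c q
  atQ c with c ≟ c₀
  ... | yes refl = ≤-antisym (r≤q c) (subst (_≤ F c r) (sym up) (≤∧≢⇒< (p≤r c) (neq ∘ sym)))
  ... | no c≢c₀  = ≤-antisym (r≤q c) (subst (_≤ F c r) (sym (fixed c c≢c₀)) (p≤r c))

-- Paths, leaves and grafting

mutual
  pathTo⇒∈ : ∀ c T {p} → pathTo c T ≡ just p → c ∈ labels T
  pathTo⇒∈ c (node x cs) eq with c ≟ x
  ... | yes refl = here refl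
  ... | no _ = there (pathList⇒∈ c 0 cs eq)

  pathList⇒∈ : ∀ c j cs {p} → pathList c j cs ≡ just p → c ∈ labelsList cs
  pathList⇒∈ c j (t ∷ ts) eq with pathTo c t in e
  ... | just _  = ∈-++⁺ˡ (pathTo⇒∈ c t e)
  ... | nothing = ∈-++⁺ʳ (labels t) (pathList⇒∈ c (suc j) ts eq)

∉⇒pathTo≡nothing : ∀ c T → c ∉ labels T → pathTo c T ≡ nothing
∉⇒pathTo≡nothing c T c∉T with pathTo c T in e
... | nothing = refl
... | just _  = contradiction (pathTo⇒∈ c T e) c∉T

∉⇒pathList≡nothing : ∀ c j cs → c ∉ labelsList cs → pathList c j cs ≡ nothing
∉⇒pathList≡nothing c j cs c∉cs with pathList c j cs in e
... | nothing = refl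
... | just _  = contradiction (pathList⇒∈ c j cs e) c∉cs

mutual
  ∈⇒pathTo : ∀ c T → c ∈ labels T → ∃ λ p → pathTo c T ≡ just p
  ∈⇒pathTo c (node x cs) c∈T with c ≟ x | c∈T
  ... | yes _ | _          = [] , refl
  ... | no c≢x | here c≡x  = contradiction c≡x c≢x
  ... | no _  | there c∈cs = ∈⇒pathList c 0 cs c∈cs

  ∈⇒pathList : ∀ c j cs → c ∈ labelsList cs → ∃ λ p → pathList c j cs ≡ just p
  ∈⇒pathList c j (t ∷ ts) c∈cs with pathTo c t in e | ∈-++⁻ (labels t) c∈cs
  ... | just q  | _          = j ∷ q , refl
  ... | nothing | inj₁ c∈t   = contradiction (proj₂ (∈⇒pathTo c t c∈t)) (λ e′ → just≢nothing (trans (sym e′) e))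
  ... | nothing | inj₂ c∈ts  = ∈⇒pathList c (suc j) ts c∈ts

pathList-head : ∀ c j cs {p} → pathList c j cs ≡ just p → ∃₂ λ i p′ → p ≡ i ∷ p′ × j ≤ i
pathList-head c j (t ∷ ts) eq with pathTo c t
... | just q  = j , q , sym (just-injective eq) , ≤-refl
... | nothing with pathList-head c (suc j) ts eq
...   | i , p′ , refl , j<i = i , p′ , refl , <⇒≤ j<i

mutual
  leafPaths : Tree → List (List ℕ)
  leafPaths leaf        = [] ∷ []
  leafPaths (node _ cs) = leafPathsL 0 cs

  leafPathsL : ℕ → List Tree → List (List ℕ)
  leafPathsL j []       = []
  leafPathsL j (t ∷ ts) = map (j ∷_) (leafPaths t) ++ leafPathsL (suc j) ts

-- In LeafPathL j i p cs the children cs are numbered from j on, and i ∷ p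
-- is the path through child number i.
mutual
  data LeafPath : List ℕ → Tree → Set where
    leaf-here : LeafPath [] leaf
    leaf-node : ∀ {x i p cs} → LeafPathL 0 i p cs → LeafPath (i ∷ p) (node x cs)

  data LeafPathL : ℕ → ℕ → List ℕ → List Tree → Set where
    in-head : ∀ {j p t ts} → LeafPath p t → LeafPathL j j p (t ∷ ts)
    in-tail : ∀ {j i p t ts} → LeafPathL (suc j) i p ts → LeafPathL j i p (t ∷ ts)

LeafPathL-index : ∀ {j i p cs} → LeafPathL j i p cs → j ≤ i
LeafPathL-index (in-head _) = ≤-refl
LeafPathL-index (in-tail l) = <⇒≤ (LeafPathL-index l)

in-tail-index : ∀ {j i p ts} → LeafPathL (suc j) i p ts → i ≢ j
in-tail-index l = >⇒≢ (LeafPathL-index l)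

mutual
  LeafPath⇒∈ : ∀ {p T} → LeafPath p T → p ∈ leafPaths T
  LeafPath⇒∈ leaf-here    = here refl
  LeafPath⇒∈ (leaf-node l) = LeafPathL⇒∈ l

  LeafPathL⇒∈ : ∀ {j i p cs} → LeafPathL j i p cs → i ∷ p ∈ leafPathsL j cs
  LeafPathL⇒∈ (in-head l)           = ∈-++⁺ˡ (∈-map⁺ _ (LeafPath⇒∈ l))
  LeafPathL⇒∈ (in-tail {t = t} l) = ∈-++⁺ʳ (map _ (leafPaths t)) (LeafPathL⇒∈ l)

mutual
  ∈⇒LeafPath : ∀ {p} T → p ∈ leafPaths T → LeafPath p T
  ∈⇒LeafPath leaf (here refl) = leaf-here
  ∈⇒LeafPath leaf (there ())
  ∈⇒LeafPath (node x cs) p∈T with ∈⇒LeafPathL 0 cs p∈T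
  ... | _ , _ , refl , l = leaf-node l

  ∈⇒LeafPathL : ∀ {q} j cs → q ∈ leafPathsL j cs → ∃₂ λ i p → q ≡ i ∷ p × LeafPathL j i p cs
  ∈⇒LeafPathL j (t ∷ ts) q∈cs with ∈-++⁻ (map (j ∷_) (leafPaths t)) q∈cs
  ... | inj₁ q∈t with ∈-map⁻ (j ∷_) q∈t
  ...   | p , p∈t , refl = j , p , refl , in-head (∈⇒LeafPath t p∈t)
  ∈⇒LeafPathL j (t ∷ ts) q∈cs | inj₂ q∈ts with ∈⇒LeafPathL (suc j) ts q∈ts
  ...   | i , p , refl , l = i , p , refl , in-tail l

mutual
  leafPaths-unique : ∀ T → Unique (leafPaths T)
  leafPaths-unique leaf        = [] ∷ []
  leafPaths-unique (node _ cs) = leafPathsL-unique 0 cs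

  leafPathsL-unique : ∀ j cs → Unique (leafPathsL j cs)
  leafPathsL-unique j []       = []
  leafPathsL-unique j (t ∷ ts) =
    Unique.++⁺ (Unique.map⁺ ∷-injectiveʳ (leafPaths-unique t)) (leafPathsL-unique (suc j) ts) disjoint
    where
    disjoint : Disjoint (map (j ∷_) (leafPaths t)) (leafPathsL (suc j) ts)
    disjoint (q∈t , q∈ts) with ∈-map⁻ (j ∷_) q∈t | ∈⇒LeafPathL (suc j) ts q∈ts
    ... | _ , _ , refl | _ , _ , refl , l = <-irrefl refl (LeafPathL-index l)

firstLeaf : Tree → List ℕ
firstLeaf leaf             = []
firstLeaf (node _ [])      = []
firstLeaf (node _ (t ∷ _)) = 0 ∷ firstLeaf t

mutual
  lastLeaf : Tree → List ℕ
  lastLeaf leaf        = []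
  lastLeaf (node _ cs) = lastLeafL 0 cs

  lastLeafL : ℕ → List Tree → List ℕ
  lastLeafL j []           = []
  lastLeafL j (t ∷ [])     = j ∷ lastLeaf t
  lastLeafL j (_ ∷ u ∷ us) = lastLeafL (suc j) (u ∷ us)

lastLeafL-index : ∀ j t ts → ∃ λ q → lastLeafL j (t ∷ ts) ≡ (j + length ts) ∷ q
lastLeafL-index j t []       = lastLeaf t , cong (_∷ lastLeaf t) (sym (+-identityʳ j))
lastLeafL-index j t (u ∷ us) with lastLeafL-index (suc j) u us
... | q , e = q , trans e (cong (_∷ q) (sym (+-suc j (length us))))

mutual
  graft : Tree → List ℕ → Tree → Tree
  graft X []      _           = X
  graft X (_ ∷ _) leaf        = leaf
  graft X (i ∷ p) (node x cs) = node x (graftL X 0 i p cs)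

  graftL : Tree → ℕ → ℕ → List ℕ → List Tree → List Tree
  graftL X j i p [] = []
  graftL X j i p (t ∷ ts) with i ≟ j
  ... | yes _ = graft X p t ∷ ts
  ... | no _  = t ∷ graftL X (suc j) i p ts

prune : List ℕ → Tree → Tree
prune = graft leaf

graftL-here : ∀ X j p t ts → graftL X j j p (t ∷ ts) ≡ graft X p t ∷ ts
graftL-here X j p t ts with j ≟ j
... | yes _  = refl
... | no j≢j = contradiction refl j≢j

graftL-skip : ∀ X {j i} p t ts → i ≢ j → graftL X j i p (t ∷ ts) ≡ t ∷ graftL X (suc j) i p ts
graftL-skip X {j} {i} p t ts i≢j with i ≟ j
... | yes i≡j = contradiction i≡j i≢j
... | no _    = refl

length-graftL : ∀ X j i p cs → length (graftL X j i p cs) ≡ length cs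
length-graftL X j i p [] = refl
length-graftL X j i p (t ∷ ts) with i ≟ j
... | yes _ = refl
... | no _  = cong suc (length-graftL X (suc j) i p ts)

mutual
  graft-graft : ∀ X Y p T → graft X p (graft Y p T) ≡ graft X p T
  graft-graft X Y []      T           = refl
  graft-graft X Y (_ ∷ _) leaf        = refl
  graft-graft X Y (i ∷ p) (node x cs) = cong (node x) (graftL-graftL X Y 0 i p cs)

  graftL-graftL : ∀ X Y j i p cs → graftL X j i p (graftL Y j i p cs) ≡ graftL X j i p cs
  graftL-graftL X Y j i p [] = refl
  graftL-graftL X Y j i p (t ∷ ts) with i ≟ j
  ... | yes refl = trans (graftL-here X i p (graft Y p t) ts) (cong (_∷ ts) (graft-graft X Y p t))
  ... | no i≢j   = trans (graftL-skip X p t _ i≢j) (cong (t ∷_) (graftL-graftL X Y (suc j) i p ts))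

mutual
  prune-leaf : ∀ {p T} → LeafPath p T → prune p T ≡ T
  prune-leaf leaf-here     = refl
  prune-leaf (leaf-node l) = cong (node _) (pruneL-leaf l)

  pruneL-leaf : ∀ {j i p cs} → LeafPathL j i p cs → graftL leaf j i p cs ≡ cs
  pruneL-leaf (in-head {j} {p} {t} {ts} l) = trans (graftL-here leaf j p t ts) (cong (_∷ ts) (prune-leaf l))
  pruneL-leaf (in-tail {p = p} {t} {ts} l) =
    trans (graftL-skip leaf p t ts (in-tail-index l)) (cong (t ∷_) (pruneL-leaf l))

prune-graft : ∀ X {p R} → LeafPath p R → prune p (graft X p R) ≡ R
prune-graft X {p} {R} l = trans (graft-graft leaf X p R) (prune-leaf l)

mutual
  pathTo-graft : ∀ c X {p R} → pathTo c X ≡ nothing → LeafPath p R → pathTo c (graft X p R) ≡ pathTo c R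
  pathTo-graft c X c∉X leaf-here = c∉X
  pathTo-graft c X c∉X (leaf-node {x} l) with c ≟ x
  ... | yes _ = refl
  ... | no _  = pathList-graftL c X c∉X l

  pathList-graftL : ∀ c X {j i p cs} → pathTo c X ≡ nothing → LeafPathL j i p cs
                  → pathList c j (graftL X j i p cs) ≡ pathList c j cs
  pathList-graftL c X c∉X (in-head {j} {p} {t} {ts} l)
    rewrite graftL-here X j p t ts | pathTo-graft c X c∉X l = refl
  pathList-graftL c X c∉X (in-tail {p = p} {t} {ts} l)
    rewrite graftL-skip X p t ts (in-tail-index l) | pathList-graftL c X c∉X l = refl

mutual
  pathTo-graft-root : ∀ m X {p R} → pathTo m X ≡ just [] → pathTo m R ≡ nothing → LeafPath p R
                    → pathTo m (graft X p R) ≡ just p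
  pathTo-graft-root m X X-root m∉R leaf-here = X-root
  pathTo-graft-root m X X-root m∉R (leaf-node {x} l) with m ≟ x
  ... | yes _ = contradiction (sym m∉R) λ ()
  ... | no _  = pathList-graftL-root m X X-root m∉R l

  pathList-graftL-root : ∀ m X {j i p cs} → pathTo m X ≡ just [] → pathList m j cs ≡ nothing
                       → LeafPathL j i p cs → pathList m j (graftL X j i p cs) ≡ just (i ∷ p)
  pathList-graftL-root m X X-root m∉cs (in-head {j} {p} {t} {ts} l)
    rewrite graftL-here X j p t ts with pathTo m t in m∉t
  ... | nothing rewrite pathTo-graft-root m X X-root m∉t l = refl
  pathList-graftL-root m X X-root m∉cs (in-tail {p = p} {t} {ts} l)
    rewrite graftL-skip X p t ts (in-tail-index l) with pathTo m t
  ... | nothing = pathList-graftL-root m X X-root m∉cs l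

mutual
  labels-graft : ∀ X {p R} → LeafPath p R → labels (graft X p R) ↭ labels X ++ labels R
  labels-graft X leaf-here = ↭-reflexive (sym (++-identityʳ (labels X)))
  labels-graft X (leaf-node {x} {cs = cs} l) =
    ↭-trans (prep x (labelsList-graftL X l)) (↭-sym (shift x (labels X) (labelsList cs)))

  labelsList-graftL : ∀ X {j i p cs} → LeafPathL j i p cs
                    → labelsList (graftL X j i p cs) ↭ labels X ++ labelsList cs
  labelsList-graftL X (in-head {j} {p} {t} {ts} l) rewrite graftL-here X j p t ts =
    ↭-trans (++⁺ʳ (labelsList ts) (labels-graft X l)) (↭-reflexive (++-assoc (labels X) (labels t) _))
  labelsList-graftL X (in-tail {p = p} {t} {ts} l) rewrite graftL-skip X p t ts (in-tail-index l) =
    ↭-trans (++⁺ˡ (labels t) (labelsList-graftL X l)) (shifts (labels t) (labels X))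

below-graftL : ∀ {x} X {j i p cs} → All (_< x) (labels X) → LeafPathL j i p cs
             → All (λ c → All (_< x) (labels c)) cs → All (λ c → All (_< x) (labels c)) (graftL X j i p cs)
below-graftL X X<x (in-head {j} {p} {t} {ts} l) (t<x ∷ ts<x) rewrite graftL-here X j p t ts =
  All-resp-↭ (↭-sym (labels-graft X l)) (All.++⁺ X<x t<x) ∷ ts<x
below-graftL X X<x (in-tail {p = p} {t} {ts} l) (t<x ∷ ts<x) rewrite graftL-skip X p t ts (in-tail-index l) =
  t<x ∷ below-graftL X X<x l ts<x

mutual
  LeafPath-prune : ∀ c T {p} → pathTo c T ≡ just p → LeafPath p (prune p T)
  LeafPath-prune c (node x cs) eq with c ≟ x
  ... | yes refl rewrite sym (just-injective eq) = leaf-here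
  ... | no _ with pathList-head c 0 cs eq
  ...   | i , p′ , refl , _ = leaf-node (LeafPathL-prune c 0 cs eq)

  LeafPathL-prune : ∀ c j cs {i p} → pathList c j cs ≡ just (i ∷ p) → LeafPathL j i p (graftL leaf j i p cs)
  LeafPathL-prune c j (t ∷ ts) {i} {p} eq with pathTo c t in e
  ... | just q with just-injective eq
  ...   | refl rewrite graftL-here leaf j q t ts = in-head (LeafPath-prune c t e)
  LeafPathL-prune c j (t ∷ ts) {i} {p} eq | nothing with pathList-head c (suc j) ts eq
  ...   | _ , _ , refl , j<i rewrite graftL-skip leaf p t ts (>⇒≢ j<i) = in-tail (LeafPathL-prune c (suc j) ts eq)

mutual
  All-prune : ∀ {P : ℕ → Set} p T → All P (labels T) → All P (labels (prune p T))
  All-prune []      T           _         = []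
  All-prune (_ ∷ _) leaf        _         = []
  All-prune (i ∷ p) (node x cs) (Px ∷ P*) = Px ∷ All-pruneL 0 i p cs P*

  All-pruneL : ∀ {P : ℕ → Set} j i p cs → All P (labelsList cs) → All P (labelsList (graftL leaf j i p cs))
  All-pruneL j i p [] _ = []
  All-pruneL j i p (t ∷ ts) P* with i ≟ j
  ... | yes _ = All.++⁺ (All-prune p t (All.++⁻ˡ (labels t) P*)) (All.++⁻ʳ (labels t) P*)
  ... | no _  = All.++⁺ (All.++⁻ˡ (labels t) P*) (All-pruneL (suc j) i p ts (All.++⁻ʳ (labels t) P*))

below-pruneL : ∀ {x} j i p cs → All (λ c → All (_< x) (labels c)) cs
             → All (λ c → All (_< x) (labels c)) (graftL leaf j i p cs)
below-pruneL j i p [] _ = []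
below-pruneL j i p (t ∷ ts) (t<x ∷ ts<x) with i ≟ j
... | yes _ = All-prune p t t<x ∷ ts<x
... | no _  = t<x ∷ below-pruneL (suc j) i p ts ts<x

leaf-of-bounds : ∀ {m} T → All (_< m) (labels T) → All (m ≤_) (labels T) → T ≡ leaf
leaf-of-bounds leaf        _         _         = refl
leaf-of-bounds (node _ _) (x<m ∷ _) (m≤x ∷ _) = contradiction (<-≤-trans x<m m≤x) (<-irrefl refl)

leaves-of-bounds : ∀ {m} cs → All (λ c → All (_< m) (labels c)) cs → All (m ≤_) (labelsList cs)
                 → cs ≡ replicate (length cs) leaf
leaves-of-bounds []       _            _   = refl
leaves-of-bounds (t ∷ ts) (t<m ∷ ts<m) m≤* =
  cong₂ _∷_ (leaf-of-bounds t t<m (All.++⁻ˡ (labels t) m≤*)) (leaves-of-bounds ts ts<m (All.++⁻ʳ (labels t) m≤*))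

leaf-of-no-labels : ∀ {T} → labels T ↭ [] → T ≡ leaf
leaf-of-no-labels {leaf}     _ = refl
leaf-of-no-labels {node _ _} π = contradiction π ¬x∷xs↭[]

module _ (s : ℕ → ℕ) where

  -- Inserting a minimal label

  cmpPath-≡ : ∀ c j pc pa → cmpPath s c (j ∷ pc) (j ∷ pa) ≡ cmpPath s c pc pa
  cmpPath-≡ c j pc pa with j ≟ j
  ... | yes _ = refl
  ... | no j≢j = contradiction refl j≢j

  cmpPath-< : ∀ c {i j} pc pa → i < j → cmpPath s c (j ∷ pc) (i ∷ pa) ≡ 0
  cmpPath-< c {i} {j} pc pa i<j with i ≟ j
  ... | yes refl = contradiction i<j (<-irrefl refl)
  ... | no _ with i <ᵇ j | <ᵇ-reflects-< i j
  ...   | true  | _ = refl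
  ...   | false | ofⁿ i≮j = contradiction i<j i≮j

  cmpPath-> : ∀ c {i j} pc pa → j < i → cmpPath s c (j ∷ pc) (i ∷ pa) ≡ s c
  cmpPath-> c {i} {j} pc pa j<i with i ≟ j
  ... | yes refl = contradiction j<i (<-irrefl refl)
  ... | no _ with i <ᵇ j | <ᵇ-reflects-< i j
  ...   | true  | ofʸ i<j = contradiction j<i (<-asym i<j)
  ...   | false | _ = refl

  corolla : ℕ → Tree
  corolla m = node m (replicate (suc (s m)) leaf)

  insert : ℕ → List ℕ → Tree → Tree
  insert m = graft (corolla m)

  labels-corolla : ∀ m → labels (corolla m) ≡ m ∷ []
  labels-corolla m = cong (m ∷_) (leaves (suc (s m)))
    where
    leaves : ∀ k → labelsList (replicate k leaf) ≡ []
    leaves zero    = refl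
    leaves (suc k) = leaves k

  pathTo-corolla-root : ∀ m → pathTo m (corolla m) ≡ just []
  pathTo-corolla-root m with m ≟ m
  ... | yes _  = refl
  ... | no m≢m = contradiction refl m≢m

  pathTo-corolla : ∀ c m → c ≢ m → pathTo c (corolla m) ≡ nothing
  pathTo-corolla c m c≢m = ∉⇒pathTo≡nothing c (corolla m)
    (subst (c ∉_) (sym (labels-corolla m)) λ { (here c≡m) → c≢m c≡m })

  pathTo-insert : ∀ c m {p R} → c ≢ m → LeafPath p R → pathTo c (insert m p R) ≡ pathTo c R
  pathTo-insert c m c≢m = pathTo-graft c (corolla m) (pathTo-corolla c m c≢m)

  pathTo-insert-root : ∀ m {p R} → pathTo m R ≡ nothing → LeafPath p R → pathTo m (insert m p R) ≡ just p
  pathTo-insert-root m = pathTo-graft-root m (corolla m) (pathTo-corolla-root m)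

  labels-insert : ∀ m {p R} → LeafPath p R → labels (insert m p R) ↭ m ∷ labels R
  labels-insert m {p} {R} l = subst (λ L → labels (insert m p R) ↭ L ++ labels R) (labels-corolla m) (labels-graft (corolla m) l)

  WF-corolla : ∀ m → WF s (corolla m)
  WF-corolla m = wf-node (length-replicate (suc (s m))) (All.replicate⁺ (suc (s m)) []) (leaves (suc (s m)))
    where
    leaves : ∀ k → WFList s (replicate k leaf)
    leaves zero    = wf-[]
    leaves (suc k) = wf-∷ wf-leaf (leaves k)

  mutual
    WF-graft : ∀ {X p R} → WF s X → LeafPath p R → WF s R → All (λ y → All (_< y) (labels X)) (labels R)
             → WF s (graft X p R)
    WF-graft wX leaf-here _ _ = wX
    WF-graft {X} wX (leaf-node {i = i} {p} {cs} l) (wf-node len below wcs) (X<x ∷ X<cs) =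
      wf-node (trans (length-graftL X 0 i p cs) len) (below-graftL X X<x l below) (WFList-graftL wX l wcs X<cs)

    WFList-graftL : ∀ {X j i p cs} → WF s X → LeafPathL j i p cs → WFList s cs
                  → All (λ y → All (_< y) (labels X)) (labelsList cs) → WFList s (graftL X j i p cs)
    WFList-graftL {X} wX (in-head {j} {p} {t} {ts} l) (wf-∷ wt wts) X<* rewrite graftL-here X j p t ts =
      wf-∷ (WF-graft wX l wt (All.++⁻ˡ (labels t) X<*)) wts
    WFList-graftL {X} wX (in-tail {p = p} {t} {ts} l) (wf-∷ wt wts) X<* rewrite graftL-skip X p t ts (in-tail-index l) =
      wf-∷ wt (WFList-graftL wX l wts (All.++⁻ʳ (labels t) X<*))

  WF-insert : ∀ m {p R} → LeafPath p R → WF s R → All (m <_) (labels R) → WF s (insert m p R)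
  WF-insert m l wR m<R =
    WF-graft (WF-corolla m) l wR (All.map (λ m<y → subst (All (_< _)) (sym (labels-corolla m)) (m<y ∷ [])) m<R)

  mutual
    WF-prune : ∀ p {T} → WF s T → WF s (prune p T)
    WF-prune []      _      = wf-leaf
    WF-prune (_ ∷ _) wf-leaf = wf-leaf
    WF-prune (i ∷ p) {node _ cs} (wf-node len below wcs) =
      wf-node (trans (length-graftL leaf 0 i p cs) len) (below-pruneL 0 i p cs below) (WFList-pruneL 0 i p wcs)

    WFList-pruneL : ∀ j i p {cs} → WFList s cs → WFList s (graftL leaf j i p cs)
    WFList-pruneL j i p wf-[] = wf-[]
    WFList-pruneL j i p {t ∷ ts} (wf-∷ wt wts) with i ≟ j
    ... | yes _ = wf-∷ (WF-prune p wt) wts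
    ... | no _  = wf-∷ wt (WFList-pruneL (suc j) i p wts)

  -- The subtree at the smallest label m has no internal nodes below it, so it is the corolla of m.
  mutual
    insert-at-min : ∀ m T {p} → WF s T → All (m ≤_) (labels T) → pathTo m T ≡ just p → insert m p T ≡ T
    insert-at-min m (node x cs) (wf-node len below wcs) (m≤x ∷ m≤cs) eq with m ≟ x
    ... | yes refl rewrite sym (just-injective eq) =
      cong (node m) (sym (trans (leaves-of-bounds cs below m≤cs) (cong (λ k → replicate k leaf) len)))
    ... | no _ with pathList-head m 0 cs eq
    ...   | i , p′ , refl , _ = cong (node x) (insertL-at-min m 0 cs wcs m≤cs eq)

    insertL-at-min : ∀ m j cs {i p} → WFList s cs → All (m ≤_) (labelsList cs) → pathList m j cs ≡ just (i ∷ p)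
                   → graftL (corolla m) j i p cs ≡ cs
    insertL-at-min m j (t ∷ ts) (wf-∷ wt wts) m≤* eq with pathTo m t in e
    ... | just q with just-injective eq
    ...   | refl = trans (graftL-here (corolla m) j q t ts) (cong (_∷ ts) (insert-at-min m t wt (All.++⁻ˡ (labels t) m≤*) e))
    insertL-at-min m j (t ∷ ts) {p = p} (wf-∷ wt wts) m≤* eq | nothing with pathList-head m (suc j) ts eq
    ...   | _ , _ , refl , j<i =
      trans (graftL-skip (corolla m) p t ts (>⇒≢ j<i))
        (cong (t ∷_) (insertL-at-min m (suc j) ts wts (All.++⁻ʳ (labels t) m≤*) eq))

  insert-prune : ∀ m T {p} → WF s T → All (m ≤_) (labels T) → pathTo m T ≡ just p → insert m p (prune p T) ≡ T
  insert-prune m T {p} wT m≤T eq = trans (graft-graft (corolla m) leaf p T) (insert-at-min m T wT m≤T eq)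

  insert-injective : ∀ {m p q R R′} → LeafPath p R → LeafPath q R′ → pathTo m R ≡ nothing → pathTo m R′ ≡ nothing
                   → insert m p R ≡ insert m q R′ → p ≡ q × R ≡ R′
  insert-injective {m} {p} {q} {R} {R′} l l′ m∉R m∉R′ eq = p≡q , (begin
    R                        ≡⟨ prune-graft (corolla m) l ⟨
    prune p (insert m p R)   ≡⟨ cong₂ prune p≡q eq ⟩
    prune q (insert m q R′)  ≡⟨ prune-graft (corolla m) l′ ⟩
    R′                       ∎)
    where
    open ≡-Reasoning
    p≡q : p ≡ q
    p≡q = just-injective (begin
      just p                   ≡⟨ pathTo-insert-root m m∉R l ⟨
      pathTo m (insert m p R)  ≡⟨ cong (pathTo m) eq ⟩
      pathTo m (insert m q R′) ≡⟨ pathTo-insert-root m m∉R′ l′ ⟩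
      just q                   ∎)

  mutual
    head-leafPaths : ∀ {T} → WF s T → head (leafPaths T) ≡ just (firstLeaf T)
    head-leafPaths wf-leaf = refl
    head-leafPaths (wf-node {cs = t ∷ ts} _ _ (wf-∷ wt _)) = head-leafPathsL 0 {t} {ts} wt

    head-leafPathsL : ∀ j {t ts} → WF s t → head (leafPathsL j (t ∷ ts)) ≡ just (j ∷ firstLeaf t)
    head-leafPathsL j {t} wt =
      head-++ (map (j ∷_) (leafPaths t))
        (trans (head-map {f = j ∷_} (leafPaths t)) (cong (Maybe.map (j ∷_)) (head-leafPaths wt)))

  mutual
    last-leafPaths : ∀ {T} → WF s T → last (leafPaths T) ≡ just (lastLeaf T)
    last-leafPaths wf-leaf = refl
    last-leafPaths (wf-node {cs = t ∷ ts} _ _ wcs) = last-leafPathsL 0 wcs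

    last-leafPathsL : ∀ j {t ts} → WFList s (t ∷ ts) → last (leafPathsL j (t ∷ ts)) ≡ just (lastLeafL j (t ∷ ts))
    last-leafPathsL j {t} {[]} (wf-∷ wt _) = begin
      last (map (j ∷_) (leafPaths t) ++ [])    ≡⟨ cong last (++-identityʳ (map (j ∷_) (leafPaths t))) ⟩
      last (map (j ∷_) (leafPaths t))          ≡⟨ last-map (j ∷_) (leafPaths t) ⟩
      Maybe.map (j ∷_) (last (leafPaths t))    ≡⟨ cong (Maybe.map (j ∷_)) (last-leafPaths wt) ⟩
      just (j ∷ lastLeaf t)                    ∎
      where open ≡-Reasoning
    last-leafPathsL j {t} {_ ∷ _} (wf-∷ _ wts) = last-++ (map (j ∷_) (leafPaths t)) (last-leafPathsL (suc j) wts)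

  firstLeaf-LeafPath : ∀ {T} → WF s T → LeafPath (firstLeaf T) T
  firstLeaf-LeafPath {T} wT = ∈⇒LeafPath T (head⇒∈ (leafPaths T) (head-leafPaths wT))

  lastLeaf-LeafPath : ∀ {T} → WF s T → LeafPath (lastLeaf T) T
  lastLeaf-LeafPath {T} wT = ∈⇒LeafPath T (last⇒∈ (leafPaths T) (last-leafPaths wT))

  cmpPath-firstLeaf : ∀ c T {pc} → WF s T → pathTo c T ≡ just pc → cmpPath s c pc (firstLeaf T) ≡ 0
  cmpPath-firstLeaf c (node x (t ∷ ts)) (wf-node _ _ (wf-∷ wt _)) eq with c ≟ x
  ... | yes _ rewrite sym (just-injective eq) = refl
  ... | no _ with pathTo c t in e
  ...   | just q rewrite sym (just-injective eq) = trans (cmpPath-≡ c 0 q (firstLeaf t)) (cmpPath-firstLeaf c t wt e)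
  ...   | nothing with pathList-head c 1 ts eq
  ...     | _ , pc′ , refl , 0<k = cmpPath-< c pc′ (firstLeaf t) 0<k

  mutual
    cmpPath-lastLeaf : ∀ c T {pc} → WF s T → pathTo c T ≡ just pc → cmpPath s c pc (lastLeaf T) ≡ s c
    cmpPath-lastLeaf c (node x (t ∷ ts)) (wf-node len _ wcs) eq with c ≟ x
    ... | yes refl rewrite sym (just-injective eq) with lastLeafL-index 0 t ts
    ...   | q , e rewrite e = suc-injective len
    cmpPath-lastLeaf c (node x (t ∷ ts)) (wf-node _ _ wcs) eq | no _ = cmpPath-lastLeafL c 0 wcs eq

    cmpPath-lastLeafL : ∀ c j {t ts pc} → WFList s (t ∷ ts) → pathList c j (t ∷ ts) ≡ just pc
                      → cmpPath s c pc (lastLeafL j (t ∷ ts)) ≡ s c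
    cmpPath-lastLeafL c j {t} {[]} (wf-∷ wt _) eq with pathTo c t in e
    ... | just q rewrite sym (just-injective eq) = trans (cmpPath-≡ c j q (lastLeaf t)) (cmpPath-lastLeaf c t wt e)
    cmpPath-lastLeafL c j {t} {u ∷ us} (wf-∷ wt wts) eq with pathTo c t in e
    ... | just q rewrite sym (just-injective eq) with lastLeafL-index (suc j) u us
    ...   | q′ , e′ rewrite e′ = cmpPath-> c q q′ (s≤s (m≤m+n j (length us)))
    cmpPath-lastLeafL c j {t} {u ∷ us} (wf-∷ wt wts) eq | nothing = cmpPath-lastLeafL c (suc j) wts eq

  cmpPath? : ℕ → Maybe (List ℕ) → List ℕ → ℕ
  cmpPath? c (just pc) = cmpPath s c pc
  cmpPath? c nothing   = λ _ → 0

  -- leafCard R c p is card(c, m) in insert m p R.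
  leafCard : Tree → ℕ → List ℕ → ℕ
  leafCard T c = cmpPath? c (pathTo c T)

  leafCardL : ℕ → List Tree → ℕ → List ℕ → ℕ
  leafCardL j cs c = cmpPath? c (pathList c j cs)

  leafCardNode : ℕ → ℕ → List Tree → ℕ → List ℕ → ℕ
  leafCardNode x j cs c with c ≟ x
  ... | yes _ = cmpPath s c []
  ... | no _  = leafCardL j cs c

  leafCard-node : ∀ x cs c p → leafCard (node x cs) c p ≡ leafCardNode x 0 cs c p
  leafCard-node x cs c p with c ≟ x
  ... | yes _ = refl
  ... | no _  = refl

  leafCardNode-root : ∀ x j cs i p → leafCardNode x j cs x (i ∷ p) ≡ i
  leafCardNode-root x j cs i p with x ≟ x
  ... | yes _  = refl
  ... | no x≢x = contradiction refl x≢x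

  leafCardNode-child : ∀ x j cs c p → c ≢ x → leafCardNode x j cs c p ≡ leafCardL j cs c p
  leafCardNode-child x j cs c p c≢x with c ≟ x
  ... | yes c≡x = contradiction c≡x c≢x
  ... | no _    = refl

  leafCardL-in-head : ∀ j t ts c p {pc} → pathTo c t ≡ just pc → leafCardL j (t ∷ ts) c p ≡ cmpPath s c (j ∷ pc) p
  leafCardL-in-head j t ts c p e rewrite e = refl

  leafCardL-in-tail : ∀ j t ts c p → pathTo c t ≡ nothing → leafCardL j (t ∷ ts) c p ≡ leafCardL (suc j) ts c p
  leafCardL-in-tail j t ts c p e rewrite e = refl

  leafCardL-left : ∀ j cs c {i} p → i < j → leafCardL j cs c (i ∷ p) ≡ 0
  leafCardL-left j cs c p i<j with pathList c j cs in e
  ... | nothing = refl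
  ... | just _ with pathList-head c j cs e
  ...   | _ , pc′ , refl , j≤k = cmpPath-< c pc′ p (<-≤-trans i<j j≤k)

  leafCardNode-head-tracks : ∀ x j t ts p q → All (_< x) (labels t)
                           → Tracks (leafCardNode x j (t ∷ ts)) (j ∷ p) (j ∷ q) (leafCard t) p q
  leafCardNode-head-tracks x j t ts p q t<x = tracks track
    where
    track : ∀ c → Track (leafCardNode x j (t ∷ ts)) (j ∷ p) (j ∷ q) (leafCard t) p q c
    track c with pathTo c t in e
    ... | just pc = inj₁ (copy p , copy q)
      where
      c≢x : c ≢ x
      c≢x refl = <-irrefl refl (All.lookup t<x (pathTo⇒∈ c t e))
      copy : ∀ r → leafCardNode x j (t ∷ ts) c (j ∷ r) ≡ cmpPath s c pc r
      copy r = trans (leafCardNode-child x j _ c _ c≢x) (trans (leafCardL-in-head j t ts c _ e) (cmpPath-≡ c j pc r))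
    ... | nothing = inj₂ (constant , refl)
      where
      constant : leafCardNode x j (t ∷ ts) c (j ∷ p) ≡ leafCardNode x j (t ∷ ts) c (j ∷ q)
      constant with c ≟ x
      ... | yes _ = refl
      ... | no _  = trans (leafCardL-in-tail j t ts c _ e)
                      (trans (leafCardL-left (suc j) ts c p ≤-refl)
                        (sym (trans (leafCardL-in-tail j t ts c _ e) (leafCardL-left (suc j) ts c q ≤-refl))))

  leafCardNode-tail-tracks : ∀ x j t ts {i k} p q → j < i → j < k → Disjoint (labels t) (labelsList ts)
                           → Tracks (leafCardNode x j (t ∷ ts)) (i ∷ p) (k ∷ q) (leafCardNode x (suc j) ts) (i ∷ p) (k ∷ q)
  leafCardNode-tail-tracks x j t ts {i} {k} p q j<i j<k t#ts = tracks track
    where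
    track : ∀ c → Track (leafCardNode x j (t ∷ ts)) (i ∷ p) (k ∷ q) (leafCardNode x (suc j) ts) (i ∷ p) (k ∷ q) c
    track c with c ≟ x | pathTo c t in e
    ... | yes _ | _       = inj₁ (refl , refl)
    ... | no _  | nothing = inj₁ (leafCardL-in-tail j t ts c _ e , leafCardL-in-tail j t ts c _ e)
    ... | no _  | just pc = inj₂ (trans (right p j<i) (sym (right q j<k)) , trans (absent p) (sym (absent q)))
      where
      right : ∀ {i} r → j < i → leafCardL j (t ∷ ts) c (i ∷ r) ≡ s c
      right r j<i = trans (leafCardL-in-head j t ts c _ e) (cmpPath-> c pc r j<i)
      c∉ts : pathList c (suc j) ts ≡ nothing
      c∉ts = ∉⇒pathList≡nothing c (suc j) ts (λ c∈ts → t#ts (pathTo⇒∈ c t e , c∈ts))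
      absent : ∀ {i} r → leafCardL (suc j) ts c (i ∷ r) ≡ 0
      absent r rewrite c∉ts = refl

  leafCardNode-boundary : ∀ x j t ts → WF s t → WFList s ts → ∀ {b} → head (leafPathsL (suc j) ts) ≡ just b
                        → UnitStep (leafCardNode x j (t ∷ ts)) (j ∷ lastLeaf t) b
  leafCardNode-boundary x j t (u ∷ us) wt (wf-∷ wu _) e
    rewrite sym (just-injective (trans (sym (head-leafPathsL (suc j) {u} {us} wu)) e)) =
    unitStep x (trans (leafCardNode-root x j _ _ _) (cong suc (sym (leafCardNode-root x j _ _ _)))) same
    where
    same : ∀ c → c ≢ x
         → leafCardNode x j (t ∷ u ∷ us) c (suc j ∷ firstLeaf u) ≡ leafCardNode x j (t ∷ u ∷ us) c (j ∷ lastLeaf t)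
    same c c≢x with c ≟ x
    ... | yes c≡x = contradiction c≡x c≢x
    ... | no _ with pathTo c t in e
    ...   | just pc = trans (cmpPath-> c {suc j} {j} pc _ ≤-refl) (sym (trans (cmpPath-≡ c j pc _) (cmpPath-lastLeaf c t wt e)))
    ...   | nothing with pathTo c u in e′
    ...     | just pc = trans (cmpPath-≡ c (suc j) pc _)
                          (trans (cmpPath-firstLeaf c u wu e′) (sym (cmpPath-< c {j} {suc j} pc _ ≤-refl)))
    ...     | nothing = trans (leafCardL-left (suc (suc j)) us c _ ≤-refl)
                          (sym (leafCardL-left (suc (suc j)) us c _ (m≤n⇒m≤1+n ≤-refl)))

  mutual
    leafPaths-linked : ∀ {T} → WF s T → Unique (labels T) → Linked (UnitStep (leafCard T)) (leafPaths T)
    leafPaths-linked wf-leaf _ = [-]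
    leafPaths-linked (wf-node {x} {cs} _ below wcs) (_ ∷ ucs) =
      Linked.map (UnitStep-transfer (tracks λ c → inj₁ (leafCard-node x cs c _ , leafCard-node x cs c _)))
        (leafPathsL-linked wcs below ucs)

    leafPathsL-linked : ∀ {x j cs} → WFList s cs → All (λ c → All (_< x) (labels c)) cs → Unique (labelsList cs)
                      → Linked (UnitStep (leafCardNode x j cs)) (leafPathsL j cs)
    leafPathsL-linked wf-[] [] _ = []
    leafPathsL-linked {x} {j} {t ∷ ts} (wf-∷ wt wts) (t<x ∷ ts<x) u with Unique-++⁻ (labels t) u
    ... | ut , uts , t#ts =
      Linked.++⁺ inT
        (Connected-last-head (map (j ∷_) (leafPaths t)) (leafPathsL (suc j) ts) lastT (leafCardNode-boundary x j t ts wt wts))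
        (Linked-mapWith∈ inTail inTs)
      where
      inT : Linked (UnitStep (leafCardNode x j (t ∷ ts))) (map (j ∷_) (leafPaths t))
      inT = Linked.map⁺ (Linked.map (UnitStep-transfer (leafCardNode-head-tracks x j t ts _ _ t<x)) (leafPaths-linked wt ut))
      lastT : last (map (j ∷_) (leafPaths t)) ≡ just (j ∷ lastLeaf t)
      lastT = trans (last-map (j ∷_) (leafPaths t)) (cong (Maybe.map (j ∷_)) (last-leafPaths wt))
      inTs : Linked (UnitStep (leafCardNode x (suc j) ts)) (leafPathsL (suc j) ts)
      inTs = leafPathsL-linked wts ts<x uts
      inTail : ∀ {a b} → a ∈ leafPathsL (suc j) ts → b ∈ leafPathsL (suc j) ts
            → UnitStep (leafCardNode x (suc j) ts) a b → UnitStep (leafCardNode x j (t ∷ ts)) a b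
      inTail a∈ b∈ with ∈⇒LeafPathL (suc j) ts a∈ | ∈⇒LeafPathL (suc j) ts b∈
      ... | _ , _ , refl , la | _ , _ , refl , lb =
        UnitStep-transfer (leafCardNode-tail-tracks x j t ts _ _ (LeafPathL-index la) (LeafPathL-index lb) t#ts)

  leafCardNode-root-agree : ∀ {x j cs i p k q} → (∀ c → leafCardNode x j cs c (i ∷ p) ≡ leafCardNode x j cs c (k ∷ q))
                          → i ≡ k
  leafCardNode-root-agree {x} {j} {cs} {i} {p} {k} {q} agree =
    trans (sym (leafCardNode-root x j cs i p)) (trans (agree x) (leafCardNode-root x j cs k q))

  mutual
    leafCard-injective : ∀ {T p q} → WF s T → Unique (labels T) → LeafPath p T → LeafPath q T
                       → (∀ c → leafCard T c p ≡ leafCard T c q) → p ≡ q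
    leafCard-injective wf-leaf _ leaf-here leaf-here _ = refl
    leafCard-injective (wf-node {x} {cs} _ below wcs) (_ ∷ ucs) (leaf-node lp) (leaf-node lq) agree =
      leafCardNode-injective wcs below ucs lp lq
        λ c → trans (sym (leafCard-node x cs c _)) (trans (agree c) (leafCard-node x cs c _))

    leafCardNode-injective : ∀ {x j cs i p k q} → WFList s cs → All (λ c → All (_< x) (labels c)) cs
                           → Unique (labelsList cs)
                           → LeafPathL j i p cs → LeafPathL j k q cs
                           → (∀ c → leafCardNode x j cs c (i ∷ p) ≡ leafCardNode x j cs c (k ∷ q)) → i ∷ p ≡ k ∷ q
    leafCardNode-injective {x} {j} (wf-∷ wt _) (t<x ∷ _) u (in-head lp) (in-head lq) agree =
      cong (j ∷_) (leafCard-injective wt (proj₁ (Unique-++⁻ _ u)) lp lq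
        (agree-transfer (leafCardNode-head-tracks x j _ _ _ _ t<x) agree))
    leafCardNode-injective _ _ _ (in-head _) (in-tail lq) agree =
      contradiction (leafCardNode-root-agree agree) (<⇒≢ (LeafPathL-index lq))
    leafCardNode-injective _ _ _ (in-tail lp) (in-head _) agree =
      contradiction (sym (leafCardNode-root-agree agree)) (<⇒≢ (LeafPathL-index lp))
    leafCardNode-injective {x} {j} {t ∷ ts} (wf-∷ _ wts) (_ ∷ ts<x) u (in-tail lp) (in-tail lq) agree
      with Unique-++⁻ (labels t) u
    ... | _ , uts , t#ts = leafCardNode-injective wts ts<x uts lp lq
            (agree-transfer (leafCardNode-tail-tracks x j t ts _ _ (LeafPathL-index lp) (LeafPathL-index lq) t#ts) agree)

  cardOf : ℕ → Maybe (List ℕ) → Maybe (List ℕ) → ℕ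
  cardOf c mpc (just pa) = cmpPath? c mpc pa
  cardOf c mpc nothing   = 0

  card≡cardOf : ∀ T c a → card s T c a ≡ cardOf c (pathTo c T) (pathTo a T)
  card≡cardOf T c a with pathTo c T | pathTo a T
  ... | just _  | just _  = refl
  ... | just _  | nothing = refl
  ... | nothing | just _  = refl
  ... | nothing | nothing = refl

  card-insert : ∀ m {p R} c a → c ≢ m → a ≢ m → LeafPath p R → card s (insert m p R) c a ≡ card s R c a
  card-insert m {p} {R} c a c≢m a≢m l = begin
    card s (insert m p R) c a                                     ≡⟨ card≡cardOf (insert m p R) c a ⟩
    cardOf c (pathTo c (insert m p R)) (pathTo a (insert m p R))
      ≡⟨ cong₂ (cardOf c) (pathTo-insert c m c≢m l) (pathTo-insert a m a≢m l) ⟩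
    cardOf c (pathTo c R) (pathTo a R)                            ≡⟨ card≡cardOf R c a ⟨
    card s R c a                                                  ∎
    where open ≡-Reasoning

  card-insert-root : ∀ m {p R} c → c ≢ m → pathTo m R ≡ nothing → LeafPath p R
                   → card s (insert m p R) c m ≡ leafCard R c p
  card-insert-root m {p} {R} c c≢m m∉R l =
    trans (card≡cardOf (insert m p R) c m) (cong₂ (cardOf c) (pathTo-insert c m c≢m l) (pathTo-insert-root m m∉R l))

  card-absent₁ : ∀ T c a → pathTo c T ≡ nothing → card s T c a ≡ 0
  card-absent₁ T c a c∉T rewrite card≡cardOf T c a | c∉T with pathTo a T
  ... | just _  = refl
  ... | nothing = refl

  card-absent₂ : ∀ T c a → pathTo a T ≡ nothing → card s T c a ≡ 0
  card-absent₂ T c a a∉T = trans (card≡cardOf T c a) (cong (cardOf c _) a∉T)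

  pathTo-below : ∀ {m a R} → All (m <_) (labels R) → a ≤ m → pathTo a R ≡ nothing
  pathTo-below {R = R} m<R a≤m = ∉⇒pathTo≡nothing _ R λ a∈R → <-irrefl refl (≤-<-trans a≤m (All.lookup m<R a∈R))

  -- Zigzag lists of insertions

  orient : Bool → List (List ℕ) → List (List ℕ)
  orient true  = id
  orient false = reverse

  orient-↭ : ∀ b xs → orient b xs ↭ xs
  orient-↭ true  _  = ↭-refl
  orient-↭ false xs = ↭-reverse xs

  startLeaf : Bool → Tree → List ℕ
  startLeaf true  = firstLeaf
  startLeaf false = lastLeaf

  block : ℕ → Bool → Tree → List Tree
  block m b R = map (λ p → insert m p R) (orient b (leafPaths R))

  zigzag : ℕ → Bool → List Tree → List Tree
  zigzag m b []       = []
  zigzag m b (R ∷ Rs) = block m b R ++ zigzag m (not b) Rs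

  head-block : ∀ m b {R} → WF s R → head (block m b R) ≡ just (insert m (startLeaf b R) R)
  head-block m true  {R} wR = trans (head-map (leafPaths R)) (cong (Maybe.map _) (head-leafPaths wR))
  head-block m false {R} wR =
    trans (head-map (reverse (leafPaths R))) (cong (Maybe.map _) (trans (head-reverse (leafPaths R)) (last-leafPaths wR)))

  last-block : ∀ m b {R} → WF s R → last (block m b R) ≡ just (insert m (startLeaf (not b) R) R)
  last-block m true  {R} wR = trans (last-map _ (leafPaths R)) (cong (Maybe.map _) (last-leafPaths wR))
  last-block m false {R} wR =
    trans (last-map _ (reverse (leafPaths R))) (cong (Maybe.map _) (trans (last-reverse (leafPaths R)) (head-leafPaths wR)))

  ∈-zigzag⁻ : ∀ m b Rs {T} → T ∈ zigzag m b Rs → ∃₂ λ R p → R ∈ Rs × p ∈ leafPaths R × T ≡ insert m p R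
  ∈-zigzag⁻ m b (R ∷ Rs) T∈ with ∈-++⁻ (block m b R) T∈
  ... | inj₁ T∈R with ∈-map⁻ (λ p → insert m p R) T∈R
  ...   | p , p∈ , refl = R , p , here refl , ∈-resp-↭ (orient-↭ b _) p∈ , refl
  ∈-zigzag⁻ m b (R ∷ Rs) T∈ | inj₂ T∈Rs with ∈-zigzag⁻ m (not b) Rs T∈Rs
  ...   | R′ , p , R′∈ , p∈ , refl = R′ , p , there R′∈ , p∈ , refl

  ∈-zigzag⁺ : ∀ m b {Rs R p} → R ∈ Rs → p ∈ leafPaths R → insert m p R ∈ zigzag m b Rs
  ∈-zigzag⁺ m b {R ∷ _} (here refl) p∈ = ∈-++⁺ˡ (∈-map⁺ _ (∈-resp-↭ (↭-sym (orient-↭ b _)) p∈))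
  ∈-zigzag⁺ m b {R ∷ _} (there R∈)  p∈ = ∈-++⁺ʳ (block m b R) (∈-zigzag⁺ m (not b) R∈ p∈)

  module _ (n : ℕ) where

    -- Defs' notions for an arbitrary list L of labels; for L = oneTo n they are
    -- definitionally SDec s n, Covers s n, Adjacent s n and HamiltonPath s n.
    SDecOn : List ℕ → Tree → Set
    SDecOn L T = WF s T × labels T ↭ L

    CoversOn : List ℕ → Tree → Tree → Set
    CoversOn L T T′ = SDecOn L T × SDecOn L T′ × T <[ s , n ] T′
                    × (∀ U → SDecOn L U → T <[ s , n ] U → ¬ (U <[ s , n ] T′))

    AdjacentOn : List ℕ → Tree → Tree → Set
    AdjacentOn L T T′ = CoversOn L T T′ ⊎ CoversOn L T′ T

    HamiltonPathOn : List ℕ → List Tree → Set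
    HamiltonPathOn L Ts = All (SDecOn L) Ts × Unique Ts × (∀ T → SDecOn L T → T ∈ Ts) × Linked (AdjacentOn L) Ts

    Increasing : List ℕ → Set
    Increasing = AllPairs _<_

    InRange : List ℕ → Set
    InRange = All (λ x → 1 ≤ x × x ≤ n)

    labels-All : ∀ {L T} {P : ℕ → Set} → SDecOn L T → All P L → All P (labels T)
    labels-All (_ , π) = All-resp-↭ (↭-sym π)

    labels-unique : ∀ {L T} → SDecOn L T → Increasing L → Unique (labels T)
    labels-unique (_ , π) inc = Permutation.Unique-resp-↭ (setoid ℕ) (↭⇒↭ₛ (↭-sym π)) (AllPairs.map <⇒≢ inc)

    pathTo-same-labels : ∀ {L R R′ c pc} → SDecOn L R → SDecOn L R′ → pathTo c R ≡ just pc
                       → ∃ λ pc′ → pathTo c R′ ≡ just pc′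
    pathTo-same-labels {R = R} {R′} {c} (_ , π) (_ , π′) e =
      ∈⇒pathTo c R′ (∈-resp-↭ (↭-sym π′) (∈-resp-↭ π (pathTo⇒∈ c R e)))

    SDecOn-insert : ∀ {m L p R} → SDecOn L R → All (m <_) L → LeafPath p R → SDecOn (m ∷ L) (insert m p R)
    SDecOn-insert {m} sd@(wR , π) m<L l = WF-insert m l wR (labels-All sd m<L) , ↭-trans (labels-insert m l) (prep m π)

    record Decomposition (m : ℕ) (L : List ℕ) (T : Tree) : Set where
      constructor decomposition
      field
        path      : List ℕ
        rest      : Tree
        T≡insert  : T ≡ insert m path rest
        leafPath  : LeafPath path rest
        rest-sdec : SDecOn L rest

    decompose : ∀ {m L T} → SDecOn (m ∷ L) T → All (m <_) L → Decomposition m L T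
    decompose {m} {L} {T} (wT , π) m<L with ∈⇒pathTo m T (∈-resp-↭ (↭-sym π) (here refl))
    ... | p , e = decomposition p (prune p T) T≡ l (WF-prune p wT , drop-∷ labels≡)
      where
      T≡ : T ≡ insert m p (prune p T)
      T≡ = sym (insert-prune m T wT (All-resp-↭ (↭-sym π) (≤-refl ∷ All.map <⇒≤ m<L)) e)
      l : LeafPath p (prune p T)
      l = LeafPath-prune m T e
      labels≡ : m ∷ labels (prune p T) ↭ m ∷ L
      labels≡ = ↭-trans (↭-sym (labels-insert m l)) (subst (λ U → labels U ↭ m ∷ L) T≡ π)

    leafCard-everywhere : ∀ (_~_ : ℕ → ℕ → Set) {m R p q} → Reflexive _~_
                        → All (m <_) (labels R) → All (_≤ n) (labels R)
                        → (∀ c → m < c → c ≤ n → leafCard R c p ~ leafCard R c q)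
                        → ∀ c → leafCard R c p ~ leafCard R c q
    leafCard-everywhere _~_ {R = R} {p} {q} refl~ m<R R≤n h c = by-cases (pathTo c R) refl
      where
      by-cases : ∀ mp → pathTo c R ≡ mp → leafCard R c p ~ leafCard R c q
      by-cases nothing  e rewrite e = refl~
      by-cases (just _) e = h c (All.lookup m<R (pathTo⇒∈ c R e)) (All.lookup R≤n (pathTo⇒∈ c R e))

    insert-mono : ∀ {m p p′ R R′} → All (m <_) (labels R) → All (m <_) (labels R′) → LeafPath p R → LeafPath p′ R′
                → R ≤[ s , n ] R′ → (∀ c → m < c → c ≤ n → leafCard R c p ≤ leafCard R′ c p′)
                → insert m p R ≤[ s , n ] insert m p′ R′
    insert-mono {m} {p} {p′} {R} {R′} m<R m<R′ l l′ R≤R′ leaf≤ a c 1≤a a<c c≤n with a ≟ m | c ≟ m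
    ... | yes refl | yes refl = contradiction a<c (<-irrefl refl)
    ... | yes refl | no c≢m   =
      subst₂ _≤_ (sym (card-insert-root a c c≢m (pathTo-below m<R ≤-refl) l))
                 (sym (card-insert-root a c c≢m (pathTo-below m<R′ ≤-refl) l′))
        (leaf≤ c a<c c≤n)
    ... | no a≢m   | yes refl =
      subst (_≤ _) (sym (card-absent₂ (insert c p R) c a (trans (pathTo-insert a c a≢m l) (pathTo-below m<R (<⇒≤ a<c)))))
        z≤n
    ... | no a≢m   | no c≢m   =
      subst₂ _≤_ (sym (card-insert m c a c≢m a≢m l)) (sym (card-insert m c a c≢m a≢m l′)) (R≤R′ a c 1≤a a<c c≤n)

    insert-reflects-≤ : ∀ {m p p′ R R′} → All (m <_) (labels R) → All (m <_) (labels R′)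
                      → LeafPath p R → LeafPath p′ R′
                      → insert m p R ≤[ s , n ] insert m p′ R′ → R ≤[ s , n ] R′
    insert-reflects-≤ {m} {p} {p′} {R} {R′} m<R m<R′ l l′ ins≤ a c 1≤a a<c c≤n with a ≟ m | c ≟ m
    ... | yes refl | _        = subst (_≤ _) (sym (card-absent₂ R c a (pathTo-below m<R ≤-refl))) z≤n
    ... | no _     | yes refl = subst (_≤ _) (sym (card-absent₁ R c a (pathTo-below m<R ≤-refl))) z≤n
    ... | no a≢m   | no c≢m   =
      subst₂ _≤_ (card-insert m c a c≢m a≢m l) (card-insert m c a c≢m a≢m l′) (ins≤ a c 1≤a a<c c≤n)

    insert-reflects-leafCard : ∀ {m p p′ R R′} → 1 ≤ m → All (m <_) (labels R) → All (m <_) (labels R′)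
                             → LeafPath p R → LeafPath p′ R′ → insert m p R ≤[ s , n ] insert m p′ R′
                             → ∀ c → m < c → c ≤ n → leafCard R c p ≤ leafCard R′ c p′
    insert-reflects-leafCard {m} 1≤m m<R m<R′ l l′ ins≤ c m<c c≤n =
      subst₂ _≤_ (card-insert-root m c c≢m (pathTo-below m<R ≤-refl) l)
                 (card-insert-root m c c≢m (pathTo-below m<R′ ≤-refl) l′)
        (ins≤ m c 1≤m m<c c≤n)
      where
      c≢m : c ≢ m
      c≢m = >⇒≢ m<c

    weak-antisym : ∀ {L R R′} → Increasing L → InRange L → SDecOn L R → SDecOn L R′
                 → R ≤[ s , n ] R′ → R′ ≤[ s , n ] R → R ≡ R′
    weak-antisym {[]} _ _ (_ , π) (_ , π′) _ _ = trans (leaf-of-no-labels π) (sym (leaf-of-no-labels π′))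
    weak-antisym {m ∷ L} (m<L ∷ inc) ((1≤m , _) ∷ rng) sd sd′ R≤R′ R′≤R with decompose sd m<L | decompose sd′ m<L
    ... | decomposition p R₀ refl l₀ sd₀ | decomposition p′ R₁ refl l₁ sd₁
      with weak-antisym inc rng sd₀ sd₁ (insert-reflects-≤ m<R₀ m<R₁ l₀ l₁ R≤R′)
                                        (insert-reflects-≤ m<R₁ m<R₀ l₁ l₀ R′≤R)
      where
      m<R₀ = labels-All sd₀ m<L
      m<R₁ = labels-All sd₁ m<L
    ...   | refl = cong (λ q → insert m q R₀) (leafCard-injective (proj₁ sd₀) (labels-unique sd₀ inc) l₀ l₁
                     (leafCard-everywhere _≡_ refl m<R₀ (labels-All sd₀ (All.map proj₂ rng)) λ c m<c c≤n →
                       ≤-antisym (insert-reflects-leafCard 1≤m m<R₀ m<R₀ l₀ l₁ R≤R′ c m<c c≤n)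
                                 (insert-reflects-leafCard 1≤m m<R₀ m<R₀ l₁ l₀ R′≤R c m<c c≤n)))
      where
      m<R₀ = labels-All sd₀ m<L

    insert-covers : ∀ {m L R p q} → Increasing (m ∷ L) → InRange (m ∷ L) → SDecOn L R → LeafPath p R → LeafPath q R
                  → UnitStep (leafCard R) p q → CoversOn (m ∷ L) (insert m p R) (insert m q R)
    insert-covers {m} {L} {R} {p} {q} (m<L ∷ inc) ((1≤m , _) ∷ rng) sd lp lq step =
      SDecOn-insert sd m<L lp , SDecOn-insert sd m<L lq , (p≤q , p≢q) , nothing-between
      where
      m<R = labels-All sd m<L
      R≤n = labels-All sd (All.map proj₂ rng)
      m∉R = pathTo-below m<R ≤-refl
      wR = proj₁ sd
      uR = labels-unique sd inc
      open UnitStep step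
      leafCard≤ : ∀ c → leafCard R c p ≤ leafCard R c q
      leafCard≤ c with c ≟ coord
      ... | yes refl = subst (_ ≤_) (sym up) (n≤1+n _)
      ... | no c≢coord = ≤-reflexive (sym (fixed c c≢coord))
      p≤q : insert m p R ≤[ s , n ] insert m q R
      p≤q = insert-mono m<R m<R lp lq (λ _ _ _ _ _ → ≤-refl) (λ c _ _ → leafCard≤ c)
      p≢q : insert m p R ≢ insert m q R
      p≢q eq with insert-injective lp lq m∉R m∉R eq
      ... | refl , _ = 1+n≢n (sym up)
      nothing-between : ∀ U → SDecOn (m ∷ L) U → insert m p R <[ s , n ] U → ¬ (U <[ s , n ] insert m q R)
      nothing-between U sdU (p≤U , p≢U) (U≤q , U≢q) with decompose sdU m<L
      ... | decomposition r R′ refl l′ sd′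
        with weak-antisym inc rng sd′ sd (insert-reflects-≤ m<R′ m<R l′ lq U≤q)
                                         (insert-reflects-≤ m<R m<R′ lp l′ p≤U)
        where m<R′ = labels-All sd′ m<L
      ...   | refl with UnitStep-between step
                         (leafCard-everywhere _≤_ ≤-refl m<R R≤n (insert-reflects-leafCard 1≤m m<R m<R lp l′ p≤U))
                         (leafCard-everywhere _≤_ ≤-refl m<R R≤n (insert-reflects-leafCard 1≤m m<R m<R l′ lq U≤q))
      ...     | inj₁ r~p = p≢U (cong (λ z → insert m z R) (sym (leafCard-injective wR uR l′ lp r~p)))
      ...     | inj₂ r~q = U≢q (cong (λ z → insert m z R) (leafCard-injective wR uR l′ lq r~q))

    record UniformLeaf (L : List ℕ) (pos : Tree → List ℕ) : Set where
      field
        leafPath : ∀ {R} → SDecOn L R → LeafPath (pos R) R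
        uniform  : ∀ {R R′} → SDecOn L R → SDecOn L R′ → ∀ c → leafCard R c (pos R) ≡ leafCard R′ c (pos R′)

    uniformLeaf : ∀ {L} pos (g : ℕ → ℕ) → (∀ {R} → WF s R → LeafPath (pos R) R)
                → (∀ {R c pc} → WF s R → pathTo c R ≡ just pc → cmpPath s c pc (pos R) ≡ g c) → UniformLeaf L pos
    uniformLeaf {L} pos g isLeaf value = record { leafPath = isLeaf ∘ proj₁ ; uniform = uniform }
      where
      uniform : ∀ {R R′} → SDecOn L R → SDecOn L R′ → ∀ c → leafCard R c (pos R) ≡ leafCard R′ c (pos R′)
      uniform {R} {R′} sd sd′ c with pathTo c R in e | pathTo c R′ in e′
      ... | just _  | just _  = trans (value (proj₁ sd) e) (sym (value (proj₁ sd′) e′))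
      ... | nothing | nothing = refl
      ... | just _  | nothing = contradiction (trans (sym (proj₂ (pathTo-same-labels sd sd′ e))) e′) just≢nothing
      ... | nothing | just _  = contradiction (trans (sym (proj₂ (pathTo-same-labels sd′ sd e′))) e) just≢nothing

    startLeaf-uniform : ∀ {L} b → UniformLeaf L (startLeaf b)
    startLeaf-uniform true  = uniformLeaf firstLeaf (λ _ → 0) firstLeaf-LeafPath (cmpPath-firstLeaf _ _)
    startLeaf-uniform false = uniformLeaf lastLeaf s lastLeaf-LeafPath (cmpPath-lastLeaf _ _)

    insert-uniform-covers : ∀ {m L pos R₁ R₂} → UniformLeaf L pos → Increasing (m ∷ L) → InRange (m ∷ L)
                          → CoversOn L R₁ R₂ → CoversOn (m ∷ L) (insert m (pos R₁) R₁) (insert m (pos R₂) R₂)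
    insert-uniform-covers {m} {L} {pos} {R₁} {R₂} U (m<L ∷ inc) ((1≤m , _) ∷ rng)
                          (sd₁ , sd₂ , (R₁≤R₂ , R₁≢R₂) , cover) =
      SDecOn-insert sd₁ m<L l₁ , SDecOn-insert sd₂ m<L l₂ , (ins≤ , ins≢) , nothing-between
      where
      open UniformLeaf U
      l₁ = leafPath sd₁
      l₂ = leafPath sd₂
      m<R₁ = labels-All sd₁ m<L
      m<R₂ = labels-All sd₂ m<L
      ins≤ : insert m (pos R₁) R₁ ≤[ s , n ] insert m (pos R₂) R₂
      ins≤ = insert-mono m<R₁ m<R₂ l₁ l₂ R₁≤R₂ (λ c _ _ → ≤-reflexive (uniform sd₁ sd₂ c))
      ins≢ : insert m (pos R₁) R₁ ≢ insert m (pos R₂) R₂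
      ins≢ eq = R₁≢R₂ (proj₂ (insert-injective l₁ l₂ (pathTo-below m<R₁ ≤-refl) (pathTo-below m<R₂ ≤-refl) eq))
      nothing-between : ∀ U → SDecOn (m ∷ L) U
                      → insert m (pos R₁) R₁ <[ s , n ] U → ¬ (U <[ s , n ] insert m (pos R₂) R₂)
      nothing-between U sdU (ins≤U , ins≢U) (U≤ins , U≢ins) with decompose sdU m<L
      ... | decomposition r R′ refl l′ sd′ = cover R′ sd′ (R₁≤R′ , R₁≢R′) (R′≤R₂ , R′≢R₂)
        where
        m<R′ = labels-All sd′ m<L
        r≡pos : r ≡ pos R′
        r≡pos = leafCard-injective (proj₁ sd′) (labels-unique sd′ inc) l′ (leafPath sd′)
          (leafCard-everywhere _≡_ refl m<R′ (labels-All sd′ (All.map proj₂ rng)) λ c m<c c≤n → ≤-antisym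
            (subst (leafCard R′ c r ≤_) (uniform sd₂ sd′ c)
              (insert-reflects-leafCard 1≤m m<R′ m<R₂ l′ l₂ U≤ins c m<c c≤n))
            (subst (_≤ leafCard R′ c r) (uniform sd₁ sd′ c)
              (insert-reflects-leafCard 1≤m m<R₁ m<R′ l₁ l′ ins≤U c m<c c≤n)))
        R₁≤R′ = insert-reflects-≤ m<R₁ m<R′ l₁ l′ ins≤U
        R′≤R₂ = insert-reflects-≤ m<R′ m<R₂ l′ l₂ U≤ins
        R₁≢R′ : R₁ ≢ R′
        R₁≢R′ e = ins≢U (trans (cong (λ z → insert m (pos z) z) e) (cong (λ z → insert m z R′) (sym r≡pos)))
        R′≢R₂ : R′ ≢ R₂
        R′≢R₂ e = U≢ins (trans (cong (λ z → insert m z R′) r≡pos) (cong (λ z → insert m (pos z) z) e))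

    -- The Hamilton path

    module _ {m L} (inc : Increasing (m ∷ L)) (rng : InRange (m ∷ L)) where

      block-linked : ∀ b {R} → SDecOn L R → Linked (AdjacentOn (m ∷ L)) (block m b R)
      block-linked true {R} sd@(wR , _) = Linked.map⁺ (Linked-mapWith∈
        (λ p∈ q∈ step → inj₁ (insert-covers inc rng sd (∈⇒LeafPath R p∈) (∈⇒LeafPath R q∈) step))
        (leafPaths-linked wR (labels-unique sd (AllPairs.tail inc))))
      block-linked false {R} sd@(wR , _) = Linked.map⁺ (Linked-mapWith∈
        (λ p∈ q∈ step → inj₂ (insert-covers inc rng sd (reversed q∈) (reversed p∈) step))
        (Linked-reverse (leafPaths-linked wR (labels-unique sd (AllPairs.tail inc)))))
        where
        reversed : ∀ {p} → p ∈ reverse (leafPaths R) → LeafPath p R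
        reversed p∈ = ∈⇒LeafPath R (∈-resp-↭ (↭-reverse _) p∈)

      zigzag-linked : ∀ b {Rs} → All (SDecOn L) Rs → Linked (AdjacentOn L) Rs → Linked (AdjacentOn (m ∷ L)) (zigzag m b Rs)
      zigzag-linked b {[]}     _           _ = []
      zigzag-linked b {R ∷ Rs} (sd ∷ sds) l =
        Linked.++⁺ (block-linked b sd)
          (Connected-last-head (block m b R) (zigzag m (not b) Rs) (last-block m b (proj₁ sd)) (connect l sds))
          (zigzag-linked (not b) sds (Linked.tail l))
        where
        lift : ∀ {R′} → AdjacentOn L R R′
             → AdjacentOn (m ∷ L) (insert m (startLeaf (not b) R) R) (insert m (startLeaf (not b) R′) R′)
        lift (inj₁ R⋖R′) = inj₁ (insert-uniform-covers (startLeaf-uniform (not b)) inc rng R⋖R′)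
        lift (inj₂ R′⋖R) = inj₂ (insert-uniform-covers (startLeaf-uniform (not b)) inc rng R′⋖R)
        connect : ∀ {Rs T} → Linked (AdjacentOn L) (R ∷ Rs) → All (SDecOn L) Rs → head (zigzag m (not b) Rs) ≡ just T
                → AdjacentOn (m ∷ L) (insert m (startLeaf (not b) R) R) T
        connect {R′ ∷ _} (R~R′ ∷ _) (sd′ ∷ _) e
          rewrite sym (just-injective (trans (sym (head-++ (block m (not b) R′) (head-block m (not b) (proj₁ sd′)))) e))
          = lift R~R′

      zigzag-sdec : ∀ b {Rs} → All (SDecOn L) Rs → All (SDecOn (m ∷ L)) (zigzag m b Rs)
      zigzag-sdec b {Rs} sds = All.tabulate λ T∈ → go (∈-zigzag⁻ m b Rs T∈)
        where
        go : ∀ {T} → ∃₂ (λ R p → R ∈ Rs × p ∈ leafPaths R × T ≡ insert m p R) → SDecOn (m ∷ L) T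
        go (R , _ , R∈ , p∈ , refl) = SDecOn-insert (All.lookup sds R∈) (AllPairs.head inc) (∈⇒LeafPath R p∈)

      zigzag-unique : ∀ b {Rs} → All (SDecOn L) Rs → Unique Rs → Unique (zigzag m b Rs)
      zigzag-unique b {[]}     _          _          = []
      zigzag-unique b {R ∷ Rs} (sd ∷ sds) (R∉ ∷ uRs) = Unique.++⁺ unique-block (zigzag-unique (not b) sds uRs) disjoint
        where
        m∉ : ∀ {R′} → SDecOn L R′ → pathTo m R′ ≡ nothing
        m∉ sd′ = pathTo-below (labels-All sd′ (AllPairs.head inc)) ≤-refl
        oriented : ∀ {p} → p ∈ orient b (leafPaths R) → LeafPath p R
        oriented p∈ = ∈⇒LeafPath R (∈-resp-↭ (orient-↭ b _) p∈)
        unique-block : Unique (block m b R)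
        unique-block =
          Unique-map⁺-∈ (λ p∈ q∈ eq → proj₁ (insert-injective (oriented p∈) (oriented q∈) (m∉ sd) (m∉ sd) eq))
          (Permutation.Unique-resp-↭ (setoid (List ℕ)) (↭⇒↭ₛ (↭-sym (orient-↭ b _))) (leafPaths-unique R))
        disjoint : Disjoint (block m b R) (zigzag m (not b) Rs)
        disjoint (T∈R , T∈Rs) with ∈-map⁻ (λ p → insert m p R) T∈R | ∈-zigzag⁻ m (not b) Rs T∈Rs
        ... | p , p∈ , refl | R′ , p′ , R′∈ , p′∈ , eq =
          All.lookup R∉ R′∈
            (proj₂ (insert-injective (oriented p∈) (∈⇒LeafPath R′ p′∈) (m∉ sd) (m∉ (All.lookup sds R′∈)) eq))

    hamiltonPathOn : ∀ L → Increasing L → InRange L → ∃ (HamiltonPathOn L)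
    hamiltonPathOn [] _ _ =
      leaf ∷ [] , (wf-leaf , ↭-refl) ∷ [] , [] ∷ [] , (λ T sd → here (leaf-of-no-labels (proj₂ sd))) , [-]
    hamiltonPathOn (m ∷ L) inc rng with hamiltonPathOn L (AllPairs.tail inc) (All.tail rng)
    ... | Rs , sds , uRs , complete , linked =
      zigzag m true Rs , zigzag-sdec inc rng true sds , zigzag-unique inc rng true sds uRs , complete′ ,
      zigzag-linked inc rng true sds linked
      where
      complete′ : ∀ T → SDecOn (m ∷ L) T → T ∈ zigzag m true Rs
      complete′ T sd with decompose sd (AllPairs.head inc)
      ... | decomposition p R refl l sdR = ∈-zigzag⁺ m true (complete R sdR) (LeafPath⇒∈ l)

    oneTo-increasing : Increasing (oneTo n)
    oneTo-increasing = AllPairs.map⁺ (AllPairs.applyUpTo⁺₁ id n λ i<j _ → s≤s i<j)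

    oneTo-inRange : InRange (oneTo n)
    oneTo-inRange = All.map⁺ (All.applyUpTo⁺₁ id n λ i<n → s≤s z≤n , i<n)

theorem1 : (n : ℕ) (s : ℕ → ℕ) → (∀ i → 1 ≤ i → i ≤ n → 1 ≤ s i)
    → ∃ λ p → HamiltonPath s n p
theorem1 n s _ = hamiltonPathOn s n (oneTo n) (oneTo-increasing s n) (oneTo-inRange s n)
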